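{- The relation $\to_{\mathsf{id}}\cup\to_\sigma$ on computations of $\lambda_{\copyright}$ is strongly normalizing, i.e. there is no infinite $(\to_{\mathsf{id}}\cup\to_\sigma)$-sequence.
   Context: The computational core $\lambda_{\copyright}$ has values $V,W ::= x \mid \lambda x.M$ and computations $M,N,L ::= \,!V \mid VM$ ($x$ ranging over a countable set of variables, terms up to $\alpha$-renaming). Rules: $\mathsf{id}$: $(\lambda x.!x)M \mapsto M$; $\sigma$: $(\lambda y.N)((\lambda x.M)L) \mapsto (\lambda x.(\lambda y.N)M)L$ provided $x\notin \mathrm{fv}(N)$. Contexts: $C ::= [\,] \mid\, !(\lambda x.C) \mid VC \mid (\lambda x.C)M$; $\to_\rho$ is the closure of rule $\rho$ under contexts. -}

module Defs where

open import Data.Nat using (ℕ; zero; suc)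
open import Data.Fin using (Fin; zero; suc)
open import Data.Sum using (_⊎_)

-- Terms of λ© up to α-renaming: well-scoped de Bruijn syntax.
-- Val n / Comp n : values / computations whose free variables are among n indices.
mutual
  data Val (n : ℕ) : Set where
    var : Fin n → Val n
    lam : Comp (suc n) → Val n

  data Comp (n : ℕ) : Set where
    ret : Val n → Comp n
    app : Val n → Comp n → Comp n

Ren : ℕ → ℕ → Set
Ren m n = Fin m → Fin n

liftRen : ∀ {m n} → Ren m n → Ren (suc m) (suc n)
liftRen ρ zero    = zero
liftRen ρ (suc i) = suc (ρ i)

mutual
  renV : ∀ {m n} → Ren m n → Val m → Val n
  renV ρ (var i) = var (ρ i)
  renV ρ (lam M) = lam (renC (liftRen ρ) M)

  renC : ∀ {m n} → Ren m n → Comp m → Comp n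
  renC ρ (ret V)   = ret (renV ρ V)
  renC ρ (app V M) = app (renV ρ V) (renC ρ M)

-- weakening that inserts a fresh (unused) variable at index 1:
-- used for N in σ, where index 0 is y and the new index 1 is x (x ∉ fv(N)).
wk1 : ∀ {n} → Comp (suc n) → Comp (suc (suc n))
wk1 = renC (liftRen suc)

data _↦id_ {n : ℕ} : Comp n → Comp n → Set where
  id-rule : (M : Comp n) → app (lam (ret (var zero))) M ↦id M

data _↦σ_ {n : ℕ} : Comp n → Comp n → Set where
  σ-rule : (N M : Comp (suc n)) (L : Comp n) →
    app (lam N) (app (lam M) L) ↦σ app (lam (app (lam (wk1 N)) M)) L

_↦_ : ∀ {n} → Comp n → Comp n → Set
M ↦ N = M ↦id N ⊎ M ↦σ N

data _⟶_ : ∀ {n} → Comp n → Comp n → Set where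
  root  : ∀ {n} {M N : Comp n} → M ↦ N → M ⟶ N
  ret-lam : ∀ {n} {M N : Comp (suc n)} → M ⟶ N → ret (lam M) ⟶ ret (lam N)
  app-arg : ∀ {n} (V : Val n) {M N : Comp n} → M ⟶ N → app V M ⟶ app V N
  app-lam : ∀ {n} {M N : Comp (suc n)} (L : Comp n) → M ⟶ N → app (lam M) L ⟶ app (lam N) L

module Submission where

-- Measure a computation by counting every node, but count the argument of an
-- application twice.  An id-step deletes the redex's wrapper; a σ-step moves
-- L out of the doubled argument position of (λy.N) into the undoubled one of
-- (λx.…), losing one node and one copy of L.  Both decreases survive every
-- context, so the weight descends strictly along any reduction sequence.

open import Defs
open import Data.Nat using (ℕ; suc; _+_; _*_; _<_; s≤s; z≤n)
open import Data.Nat.Properties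
  using (m≤n*m; m<n+m; m≤m+n; ≤-<-trans; +-monoʳ-<; +-monoˡ-<; *-monoʳ-<)
open import Data.Nat.Induction using (<-wellFounded)
open import Data.Nat.Tactic.RingSolver using (solve-∀)
open import Data.Fin using (Fin)
open import Data.Product using (∃; _,_)
open import Data.Sum using (inj₁; inj₂)
open import Function using (flip; _∘_)
open import Induction.WellFounded using (WellFounded; Acc; acc; module Subrelation)
open import Induction.InfiniteDescent using (InfiniteDescendingSequence)
open import Relation.Binary.Core using (Rel)
open import Relation.Binary.PropositionalEquality using (_≡_; refl; cong; cong₂)
import Relation.Binary.Construct.On as On
open import Relation.Nullary using (¬_)

acc⇒noInfiniteDescent : ∀ {a r} {A : Set a} {_<_ : Rel A r} (f : ℕ → A) →
  Acc _<_ (f 0) → ¬ InfiniteDescendingSequence _<_ f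
acc⇒noInfiniteDescent f (acc rs) desc =
  acc⇒noInfiniteDescent (f ∘ suc) (rs (desc 0)) (desc ∘ suc)

wf⇒noInfiniteDescent : ∀ {a r} {A : Set a} {_<_ : Rel A r} → WellFounded _<_ →
  (f : ℕ → A) → ¬ InfiniteDescendingSequence _<_ f
wf⇒noInfiniteDescent wf f = acc⇒noInfiniteDescent f (wf (f 0))

mutual
  weightᵛ : ∀ {n} → Val n → ℕ
  weightᵛ (var i) = 1
  weightᵛ (lam M) = suc (weightᶜ M)

  weightᶜ : ∀ {n} → Comp n → ℕ
  weightᶜ (ret V)   = suc (weightᵛ V)
  weightᶜ (app V M) = weightᵛ V + 2 * weightᶜ M

mutual
  weightᵛ-renV : ∀ {m n} (ρ : Ren m n) (V : Val m) → weightᵛ (renV ρ V) ≡ weightᵛ V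
  weightᵛ-renV ρ (var i) = refl
  weightᵛ-renV ρ (lam M) = cong suc (weightᶜ-renC (liftRen ρ) M)

  weightᶜ-renC : ∀ {m n} (ρ : Ren m n) (M : Comp m) → weightᶜ (renC ρ M) ≡ weightᶜ M
  weightᶜ-renC ρ (ret V)   = cong suc (weightᵛ-renV ρ V)
  weightᶜ-renC ρ (app V M) = cong₂ _+_ (weightᵛ-renV ρ V) (cong (2 *_) (weightᶜ-renC ρ M))

↦id⇒weight< : ∀ {n} {M N : Comp n} → M ↦id N → weightᶜ N < weightᶜ M
↦id⇒weight< (id-rule M) = ≤-<-trans (m≤n*m (weightᶜ M) 2) (m<n+m (2 * weightᶜ M) {3} (s≤s z≤n))

σ-weight-identity : ∀ n m l →
  suc n + 2 * (suc m + 2 * l) ≡ suc ((suc (suc n + 2 * m) + 2 * l) + 2 * l)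
σ-weight-identity = solve-∀

↦σ⇒weight< : ∀ {n} {M N : Comp n} → M ↦σ N → weightᶜ N < weightᶜ M
↦σ⇒weight< (σ-rule N M L)
  rewrite weightᶜ-renC (liftRen Fin.suc) N
        | σ-weight-identity (weightᶜ N) (weightᶜ M) (weightᶜ L)
        = s≤s (m≤m+n _ _)

⟶⇒weight< : ∀ {n} {M N : Comp n} → M ⟶ N → weightᶜ N < weightᶜ M
⟶⇒weight< (root (inj₁ r))   = ↦id⇒weight< r
⟶⇒weight< (root (inj₂ r))   = ↦σ⇒weight< r
⟶⇒weight< (ret-lam p)      = s≤s (s≤s (⟶⇒weight< p))
⟶⇒weight< (app-arg V p)    = +-monoʳ-< (weightᵛ V) (*-monoʳ-< 2 (⟶⇒weight< p))
⟶⇒weight< (app-lam L p)    = +-monoˡ-< (2 * weightᶜ L) (s≤s (⟶⇒weight< p))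

⟶-wellFounded : ∀ {n} → WellFounded (flip (_⟶_ {n}))
⟶-wellFounded = Subrelation.wellFounded ⟶⇒weight< (On.wellFounded weightᶜ <-wellFounded)

mainTheorem17 : ∀ {n : ℕ} →
    ¬ ∃ (λ (f : ℕ → Comp n) → ∀ i → f i ⟶ f (suc i))
mainTheorem17 (f , steps) = wf⇒noInfiniteDescent ⟶-wellFounded f steps
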